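{- Let $\sigma$ be a type tree and $A$ a normal form of type $\sigma$ with $[\![A]\!]\bot\neq\bot$, where $\bot$ also denotes the environment mapping every variable to $\emptyset$. If $\sigma=\tau+\rho$, then $A=0A'$ or $A=1A'$ for some term $A'$. If $\sigma=\tau\times\rho$, then $A=\mathrm{pair}\,A'\,A''$ for some terms $A',A''$.
   Context: Types: type expressions $\sigma ::= t \mid \sigma+\sigma \mid \sigma\times\sigma\mid \sigma\to\sigma\mid \mu t.\sigma\mid \mathrm{void}$ (types = closed ones); each type has a type tree (the ideal of finite simple-type prefixes, built from $\mathrm{void},+,\times,\to$ with $\mathrm{void}$ as least prefix, of its repeated unfoldings $\mu t.\tau\rhd\tau[\mu t.\tau/t]$), and every type tree is $\mathrm{void}$ or uniquely of the form $\tau+\rho$, $\tau\times\rho$ or $\tau\to\rho$; types with equal type trees are interchangeable in typing. Terms: typed $\lambda$-terms over typed variables and the constants, for all types $\sigma,\tau,\rho$: $0_{\sigma,\tau}:\sigma\to(\sigma+\tau)$, $1_{\sigma,\tau}:\tau\to(\sigma+\tau)$, $\mathrm{case}_{\sigma,\tau,\rho}:(\sigma+\tau)\to(\sigma\to\rho)\to(\tau\to\rho)\to\rho$, $\mathrm{pcase}_{\sigma,\tau,\rho}:(\sigma+\tau)\to\rho\to\rho\to\rho$, $\mathrm{pair}_{\sigma,\tau}:\sigma\to\tau\to(\sigma\times\tau)$, $\mathrm{fst}:(\sigma\times\tau)\to\sigma$, $\mathrm{snd}:(\sigma\times\tau)\to\tau$, $\Omega_\sigma:\sigma$. Reduction: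 $\beta$-reduction and the rules $\mathrm{case}(0x)yz\to yx$; $\mathrm{case}(1x)yz\to zx$; $\mathrm{fst}(\mathrm{pair}\,x\,y)\to x$; $\mathrm{snd}(\mathrm{pair}\,x\,y)\to y$; $\mathrm{pcase}(0x)yz\to y$; $\mathrm{pcase}(1x)yz\to z$; $\mathrm{pcase}\,x(0y)(0z)\to 0(\mathrm{pcase}\,xyz)$; $\mathrm{pcase}\,x(1y)(1z)\to 1(\mathrm{pcase}\,xyz)$; $\mathrm{pcase}\,x(\mathrm{pair}\,y_1y_2)(\mathrm{pair}\,z_1z_2)\to\mathrm{pair}(\mathrm{pcase}\,x\,y_1z_1)(\mathrm{pcase}\,x\,y_2z_2)$; $(\mathrm{pcase}\,xyz)w\to\mathrm{pcase}\,x(yw)(zw)$ (functional result type), in any context. A normal form is a term with no reduction step. Semantics: $D_\sigma$ is the domain of elements (downward closed, pairwise consistent sets of primes, $\bot=\emptyset$) of the prime system interpreting the type tree of $\sigma$; $D_{\tau+\rho}=\{\bot\}\cup\{0d\mid d\in D_\tau\}\cup\{1d\mid d\in D_\rho\}$ with $0d=\{0\}\cup(\{0\}\times d)$, $1d=\{1\}\cup(\{1\}\times d)$; $D_{\tau\times\rho}=\{\mathrm{pair}\,d\,e\}$ with $\mathrm{pair}\,d\,e=(\{0\}\times d)\cup(\{1\}\times e)$; $D_{\tau\to\rho}$ is isomorphic to the continuous functions $D_\tau\to D_\rho$. $[\![\cdot]\!]\varepsilon$: $[\![\Omega]\!]\varepsilon=\bot$; $[\![x]\!]\varepsilon=\varepsilon(x)$;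 $0,1,\mathrm{pair}$ denote $d\mapsto0d$, $d\mapsto 1d$, $(d,e)\mapsto\mathrm{pair}\,d\,e$; $\mathrm{fst},\mathrm{snd}$ the projections; $\mathrm{case}\,\bot\,f\,g=\bot$, $\mathrm{case}\,(0e)\,f\,g=f\,e$, $\mathrm{case}\,(1e)\,f\,g=g\,e$; $\mathrm{pcase}\,\bot\,b\,c=b\cap c$, $\mathrm{pcase}\,(0a)\,b\,c=b$, $\mathrm{pcase}\,(1a)\,b\,c=c$; abstraction and application are interpreted as function formation and application. -}

module Defs where

open import Data.Nat using (ℕ; zero; suc)
open import Data.Fin using (Fin; zero; suc)
open import Data.List using (List; []; _∷_)
open import Data.List.Relation.Unary.All using (All)
open import Data.List.Relation.Unary.Any using (Any)
open import Data.Product using (Σ; _×_; ∃)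
open import Data.Sum using (_⊎_)
open import Data.Unit using (⊤)
open import Data.Empty using (⊥)

-- Type expressions  σ ::= t | σ+σ | σ×σ | σ→σ | μt.σ | void
-- (type variables as de Bruijn indices; TyE n = expressions with at most
--  n free type variables; types = closed expressions)

infixr 7 _⇒_
infixr 8 _⊕_
infixr 9 _⊗_

data TyE (n : ℕ) : Set where
  tvar : Fin n → TyE n
  void : TyE n
  _⊕_  : TyE n → TyE n → TyE n
  _⊗_  : TyE n → TyE n → TyE n
  _⇒_  : TyE n → TyE n → TyE n
  μ    : TyE (suc n) → TyE n

Ty : Set
Ty = TyE 0

liftR : ∀ {m k} → (Fin m → Fin k) → Fin (suc m) → Fin (suc k)
liftR ρ zero    = zero
liftR ρ (suc i) = suc (ρ i)

tren : ∀ {m k} → (Fin m → Fin k) → TyE m → TyE k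
tren ρ (tvar i) = tvar (ρ i)
tren ρ void     = void
tren ρ (a ⊕ b)  = tren ρ a ⊕ tren ρ b
tren ρ (a ⊗ b)  = tren ρ a ⊗ tren ρ b
tren ρ (a ⇒ b)  = tren ρ a ⇒ tren ρ b
tren ρ (μ a)    = μ (tren (liftR ρ) a)

liftS : ∀ {m k} → (Fin m → TyE k) → Fin (suc m) → TyE (suc k)
liftS s zero    = tvar zero
liftS s (suc i) = tren suc (s i)

tsub : ∀ {m k} → (Fin m → TyE k) → TyE m → TyE k
tsub s (tvar i) = s i
tsub s void     = void
tsub s (a ⊕ b)  = tsub s a ⊕ tsub s b
tsub s (a ⊗ b)  = tsub s a ⊗ tsub s b
tsub s (a ⇒ b)  = tsub s a ⇒ tsub s b
tsub s (μ a)    = μ (tsub (liftS s) a)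

-- one unfolding step  μt.τ ▷ τ[μt.τ/t]  (for closed μt.τ)
unfold : TyE 1 → Ty
unfold τ = tsub (λ { zero → μ τ ; (suc ()) }) τ

data FT : Set where
  fvoid : FT
  _+ᶠ_  : FT → FT → FT
  _×ᶠ_  : FT → FT → FT
  _→ᶠ_  : FT → FT → FT

data _⊑_ : FT → FT → Set where
  void⊑ : ∀ {t} → fvoid ⊑ t
  +⊑ : ∀ {a b a' b'} → a ⊑ a' → b ⊑ b' → (a +ᶠ b) ⊑ (a' +ᶠ b')
  ×⊑ : ∀ {a b a' b'} → a ⊑ a' → b ⊑ b' → (a ×ᶠ b) ⊑ (a' ×ᶠ b')
  →⊑ : ∀ {a b a' b'} → a ⊑ a' → b ⊑ b' → (a →ᶠ b) ⊑ (a' →ᶠ b')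

approx : ℕ → Ty → FT
approx zero    _        = fvoid
approx (suc k) (tvar ())
approx (suc k) void     = fvoid
approx (suc k) (a ⊕ b)  = approx k a +ᶠ approx k b
approx (suc k) (a ⊗ b)  = approx k a ×ᶠ approx k b
approx (suc k) (a ⇒ b)  = approx k a →ᶠ approx k b
approx (suc k) (μ a)    = approx k (unfold a)

-- the type tree of σ: the ideal of finite prefixes of its unfoldings
TypeTree : Ty → FT → Set
TypeTree σ p = ∃ λ k → p ⊑ approx k σ

TreeEq : Ty → Ty → Set
TreeEq σ τ = ∀ p → (TypeTree σ p → TypeTree τ p) × (TypeTree τ p → TypeTree σ p)

infixl 10 _·_

data Tm : Set where
  var   : ℕ → Tm
  lam   : Ty → Tm → Tm
  _·_   : Tm → Tm → Tm
  c0 c1 : Tm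
  case pcase : Tm
  pair fst snd : Tm
  Ω : Tm

ext : (ℕ → ℕ) → ℕ → ℕ
ext ρ zero    = zero
ext ρ (suc i) = suc (ρ i)

rename : (ℕ → ℕ) → Tm → Tm
rename ρ (var i)   = var (ρ i)
rename ρ (lam σ M) = lam σ (rename (ext ρ) M)
rename ρ (M · N)   = rename ρ M · rename ρ N
rename ρ c0 = c0
rename ρ c1 = c1
rename ρ case = case
rename ρ pcase = pcase
rename ρ pair = pair
rename ρ fst = fst
rename ρ snd = snd
rename ρ Ω = Ω

exts : (ℕ → Tm) → ℕ → Tm
exts s zero    = var zero
exts s (suc i) = rename suc (s i)

subst : (ℕ → Tm) → Tm → Tm
subst s (var i)   = s i
subst s (lam σ M) = lam σ (subst (exts s) M)
subst s (M · N)   = subst s M · subst s N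
subst s c0 = c0
subst s c1 = c1
subst s case = case
subst s pcase = pcase
subst s pair = pair
subst s fst = fst
subst s snd = snd
subst s Ω = Ω

_[_] : Tm → Tm → Tm
M [ N ] = subst (λ { zero → N ; (suc i) → var i }) M

data _∋_∶_ : List Ty → ℕ → Ty → Set where
  here  : ∀ {Γ σ} → (σ ∷ Γ) ∋ zero ∶ σ
  there : ∀ {Γ σ τ i} → Γ ∋ i ∶ σ → (τ ∷ Γ) ∋ suc i ∶ σ

data _⊢_∶_ (Γ : List Ty) : Tm → Ty → Set where
  ⊢var   : ∀ {i σ} → Γ ∋ i ∶ σ → Γ ⊢ var i ∶ σ
  ⊢lam   : ∀ {σ τ M} → (σ ∷ Γ) ⊢ M ∶ τ → Γ ⊢ lam σ M ∶ (σ ⇒ τ)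
  ⊢app   : ∀ {σ τ M N} → Γ ⊢ M ∶ (σ ⇒ τ) → Γ ⊢ N ∶ σ → Γ ⊢ M · N ∶ τ
  ⊢c0    : ∀ {σ τ} → Γ ⊢ c0 ∶ (σ ⇒ (σ ⊕ τ))
  ⊢c1    : ∀ {σ τ} → Γ ⊢ c1 ∶ (τ ⇒ (σ ⊕ τ))
  ⊢case  : ∀ {σ τ ρ} → Γ ⊢ case ∶ ((σ ⊕ τ) ⇒ (σ ⇒ ρ) ⇒ (τ ⇒ ρ) ⇒ ρ)
  ⊢pcase : ∀ {σ τ ρ} → Γ ⊢ pcase ∶ ((σ ⊕ τ) ⇒ ρ ⇒ ρ ⇒ ρ)
  ⊢pair  : ∀ {σ τ} → Γ ⊢ pair ∶ (σ ⇒ τ ⇒ (σ ⊗ τ))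
  ⊢fst   : ∀ {σ τ} → Γ ⊢ fst ∶ ((σ ⊗ τ) ⇒ σ)
  ⊢snd   : ∀ {σ τ} → Γ ⊢ snd ∶ ((σ ⊗ τ) ⇒ τ)
  ⊢Ω     : ∀ {σ} → Γ ⊢ Ω ∶ σ
  ⊢conv  : ∀ {σ τ M} → Γ ⊢ M ∶ σ → TreeEq σ τ → Γ ⊢ M ∶ τ

infix 4 _⟶_

data _⟶_ : Tm → Tm → Set where
  β       : ∀ {σ M N} → lam σ M · N ⟶ M [ N ]
  case0   : ∀ {x y z} → case · (c0 · x) · y · z ⟶ y · x
  case1   : ∀ {x y z} → case · (c1 · x) · y · z ⟶ z · x
  fstβ    : ∀ {x y} → fst · (pair · x · y) ⟶ x
  sndβ    : ∀ {x y} → snd · (pair · x · y) ⟶ y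
  pcase0  : ∀ {x y z} → pcase · (c0 · x) · y · z ⟶ y
  pcase1  : ∀ {x y z} → pcase · (c1 · x) · y · z ⟶ z
  pcase00 : ∀ {x y z} → pcase · x · (c0 · y) · (c0 · z) ⟶ c0 · (pcase · x · y · z)
  pcase11 : ∀ {x y z} → pcase · x · (c1 · y) · (c1 · z) ⟶ c1 · (pcase · x · y · z)
  pcasePr : ∀ {x y₁ y₂ z₁ z₂} →
            pcase · x · (pair · y₁ · y₂) · (pair · z₁ · z₂)
              ⟶ pair · (pcase · x · y₁ · z₁) · (pcase · x · y₂ · z₂)
  pcaseAp : ∀ {x y z w} → pcase · x · y · z · w ⟶ pcase · x · (y · w) · (z · w)
  ξlam    : ∀ {σ M M'} → M ⟶ M' → lam σ M ⟶ lam σ M'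
  ξ₁      : ∀ {M M' N} → M ⟶ M' → M · N ⟶ M' · N
  ξ₂      : ∀ {M N N'} → N ⟶ N' → M · N ⟶ M · N'

Normal : Tm → Set
Normal A = ∀ B → A ⟶ B → ⊥

-- Semantics: elements are sets of primes, all living in one universal
-- prime syntax.  Sum:  0, 1, (0,p), (1,p)  = tag0, tag1, in0 p, in1 p.
-- Product: (0,p), (1,p) = pr0 p, pr1 p.  Function space: step a q, the
-- step function "finite consistent set a ↦ prime q".

data Prime : Set where
  tag0 tag1 : Prime
  in0 in1   : Prime → Prime
  pr0 pr1   : Prime → Prime
  step      : List Prime → Prime → Prime

data _≤ᵖ_ : Prime → Prime → Set where
  t0≤   : tag0 ≤ᵖ tag0
  t1≤   : tag1 ≤ᵖ tag1
  t0≤i0 : ∀ {p} → tag0 ≤ᵖ in0 p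
  t1≤i1 : ∀ {p} → tag1 ≤ᵖ in1 p
  i0≤   : ∀ {p q} → p ≤ᵖ q → in0 p ≤ᵖ in0 q
  i1≤   : ∀ {p q} → p ≤ᵖ q → in1 p ≤ᵖ in1 q
  p0≤   : ∀ {p q} → p ≤ᵖ q → pr0 p ≤ᵖ pr0 q
  p1≤   : ∀ {p q} → p ≤ᵖ q → pr1 p ≤ᵖ pr1 q
  st≤   : ∀ {a b p q} → All (λ x → Any (λ y → x ≤ᵖ y) a) b → p ≤ᵖ q →
          step a p ≤ᵖ step b q

mutual
  coh : Prime → Prime → Set
  coh tag0 tag0 = ⊤
  coh tag0 (in0 _) = ⊤
  coh (in0 _) tag0 = ⊤
  coh (in0 p) (in0 q) = coh p q
  coh tag1 tag1 = ⊤
  coh tag1 (in1 _) = ⊤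
  coh (in1 _) tag1 = ⊤
  coh (in1 p) (in1 q) = coh p q
  coh (pr0 p) (pr0 q) = coh p q
  coh (pr0 _) (pr1 _) = ⊤
  coh (pr1 _) (pr0 _) = ⊤
  coh (pr1 p) (pr1 q) = coh p q
  coh (step a p) (step b q) = Consistent a → Consistent b → Cross a b → coh p q
  coh _ _ = ⊥

  CohWith : Prime → List Prime → Set
  CohWith x []       = ⊤
  CohWith x (y ∷ ys) = coh x y × CohWith x ys

  Consistent : List Prime → Set
  Consistent []       = ⊤
  Consistent (x ∷ xs) = CohWith x xs × Consistent xs

  Cross : List Prime → List Prime → Set
  Cross []       b = ⊤
  Cross (x ∷ xs) b = CohWith x b × Cross xs b

Sem : Set₁
Sem = Prime → Set

∅ : Sem
∅ _ = ⊥

↓ : List Prime → Sem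
↓ a p = Any (λ y → p ≤ᵖ y) a

-- function formation: a continuous map F as set of step primes
fun : (Sem → Sem) → Sem
fun F (step a q) = Consistent a × F (↓ a) q
fun F _ = ⊥

apply : Sem → Sem → Sem
apply f d q = Σ (List Prime) λ a → f (step a q) × All d a

inj0 : Sem → Sem
inj0 d tag0    = ⊤
inj0 d (in0 p) = d p
inj0 d _       = ⊥

inj1 : Sem → Sem
inj1 d tag1    = ⊤
inj1 d (in1 p) = d p
inj1 d _       = ⊥

out0 : Sem → Sem
out0 d p = d (in0 p)

out1 : Sem → Sem
out1 d p = d (in1 p)

pairS : Sem → Sem → Sem
pairS d e (pr0 p) = d p
pairS d e (pr1 p) = e p
pairS d e _       = ⊥

fstS : Sem → Sem
fstS d p = d (pr0 p)

sndS : Sem → Sem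
sndS d p = d (pr1 p)

caseS : Sem → Sem → Sem → Sem
caseS d f g q = (d tag0 × apply f (out0 d) q) ⊎ (d tag1 × apply g (out1 d) q)

-- pcase ⊥ b c = b ∩ c, pcase (0a) b c = b, pcase (1a) b c = c
pcaseS : Sem → Sem → Sem → Sem
pcaseS d b c q = (d tag0 × b q) ⊎ (d tag1 × c q) ⊎ (b q × c q)

Env : Set₁
Env = ℕ → Sem

_∷ₑ_ : Sem → Env → Env
(d ∷ₑ ε) zero    = d
(d ∷ₑ ε) (suc i) = ε i

⊥ₑ : Env
⊥ₑ _ = ∅

⟦_⟧ : Tm → Env → Sem
⟦ var i ⟧   ε = ε i
⟦ lam σ M ⟧ ε = fun (λ d → ⟦ M ⟧ (d ∷ₑ ε))
⟦ M · N ⟧   ε = apply (⟦ M ⟧ ε) (⟦ N ⟧ ε)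
⟦ c0 ⟧      ε = fun inj0
⟦ c1 ⟧      ε = fun inj1
⟦ case ⟧    ε = fun (λ d → fun (λ f → fun (λ g → caseS d f g)))
⟦ pcase ⟧   ε = fun (λ d → fun (λ b → fun (λ c → pcaseS d b c)))
⟦ pair ⟧    ε = fun (λ d → fun (λ e → pairS d e))
⟦ fst ⟧     ε = fun fstS
⟦ snd ⟧     ε = fun sndS
⟦ Ω ⟧       ε = ∅

module Submission where

-- Every prime p has a form: left (tag0, in0 _), right (tag1, in1 _), prod
-- (pr0 _, pr1 _) or func (step _ _).  By structural induction on A, a normal
-- form A with p ∈ ⟦A⟧⊥ is canonical for the form of p: left/right primes
-- force A = 0A′ / 1A′, product primes force A = pair A′ A″, and step primes
-- force a λ-abstraction, an unsaturated constant, or pcase x y z with y again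
-- of function form; any other shape would contain a redex.  Independently,
-- typing inversion gives every canonical form a type whose tree has the
-- matching head constructor (+, × or →).  A type tree has at most one head
-- constructor, so a sum (product) type forces a left/right (product) form and
-- hence the syntactic shape.  The hypothesis only says ⟦A⟧⊥ is not empty, but
-- the shapes are decidable, so a double-negation argument suffices.

open import Defs
open import Data.List using (List)
open import Data.Product using (_×_; ∃; ∃₂)
open import Data.Sum using (_⊎_)
open import Relation.Nullary using (¬_)
open import Relation.Binary.PropositionalEquality using (_≡_)

open import Data.Nat using (ℕ; zero; suc; _⊔_; _≤′_; ≤′-refl; ≤′-step)
open import Data.Nat.Properties using (m≤m⊔n; m≤n⊔m; ≤⇒≤′)
open import Data.Product using (_,_; proj₁; proj₂)
open import Data.Sum using (inj₁; inj₂)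
open import Data.Empty using (⊥-elim)
open import Data.List.Relation.Unary.All using (All; lookupAny)
open import Relation.Nullary using (Dec; yes; no)
open import Relation.Nullary.Decidable using (decidable-stable)
open import Relation.Binary.PropositionalEquality using (refl)

⊑-refl : ∀ t → t ⊑ t
⊑-refl fvoid    = void⊑
⊑-refl (a +ᶠ b) = +⊑ (⊑-refl a) (⊑-refl b)
⊑-refl (a ×ᶠ b) = ×⊑ (⊑-refl a) (⊑-refl b)
⊑-refl (a →ᶠ b) = →⊑ (⊑-refl a) (⊑-refl b)

⊑-trans : ∀ {a b c} → a ⊑ b → b ⊑ c → a ⊑ c
⊑-trans void⊑     _         = void⊑
⊑-trans (+⊑ p q) (+⊑ r s) = +⊑ (⊑-trans p r) (⊑-trans q s)
⊑-trans (×⊑ p q) (×⊑ r s) = ×⊑ (⊑-trans p r) (⊑-trans q s)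
⊑-trans (→⊑ p q) (→⊑ r s) = →⊑ (⊑-trans p r) (⊑-trans q s)

approx-step : ∀ k σ → approx k σ ⊑ approx (suc k) σ
approx-step zero    σ         = void⊑
approx-step (suc k) (tvar ())
approx-step (suc k) void      = void⊑
approx-step (suc k) (a ⊕ b)   = +⊑ (approx-step k a) (approx-step k b)
approx-step (suc k) (a ⊗ b)   = ×⊑ (approx-step k a) (approx-step k b)
approx-step (suc k) (a ⇒ b)   = →⊑ (approx-step k a) (approx-step k b)
approx-step (suc k) (μ a)     = approx-step k (unfold a)

approx-mono : ∀ {k m} σ → k ≤′ m → approx k σ ⊑ approx m σ
approx-mono σ ≤′-refl         = ⊑-refl _
approx-mono σ (≤′-step k≤′m) = ⊑-trans (approx-mono σ k≤′m) (approx-step _ σ)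

tree-directed : ∀ {σ p q} → TypeTree σ p → TypeTree σ q →
  ∃ λ k → p ⊑ approx k σ × q ⊑ approx k σ
tree-directed {σ} (k , p⊑) (m , q⊑) =
  k ⊔ m , ⊑-trans p⊑ (approx-mono σ (≤⇒≤′ (m≤m⊔n k m)))
        , ⊑-trans q⊑ (approx-mono σ (≤⇒≤′ (m≤n⊔m k m)))

tree-down : ∀ {σ p q} → p ⊑ q → TypeTree σ q → TypeTree σ p
tree-down p⊑q (k , q⊑) = k , ⊑-trans p⊑q q⊑

≅-refl : ∀ {σ} → TreeEq σ σ
≅-refl p = (λ t → t) , (λ t → t)

≅-sym : ∀ {σ τ} → TreeEq σ τ → TreeEq τ σ
≅-sym e p = proj₂ (e p) , proj₁ (e p)

≅-trans : ∀ {σ τ ρ} → TreeEq σ τ → TreeEq τ ρ → TreeEq σ ρ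
≅-trans e f p = (λ t → proj₁ (f p) (proj₁ (e p) t)) ,
                (λ t → proj₂ (e p) (proj₂ (f p) t))

tree-transport : ∀ {σ τ p} → TypeTree σ p → TreeEq σ τ → TypeTree τ p
tree-transport t e = proj₁ (e _) t

codomain-prefix : ∀ {a b p} → TypeTree (a ⇒ b) (fvoid →ᶠ p) → TypeTree b p
codomain-prefix (zero , ())
codomain-prefix (suc k , →⊑ _ p⊑) = k , p⊑

domain-prefix : ∀ {a b p} → TypeTree (a ⇒ b) (p →ᶠ fvoid) → TypeTree a p
domain-prefix (zero , ())
domain-prefix (suc k , →⊑ p⊑ _) = k , p⊑

codomain-eq : ∀ {a b c d} → TreeEq (a ⇒ b) (c ⇒ d) → TreeEq b d
codomain-eq e p =
  (λ { (k , p⊑) → codomain-prefix (proj₁ (e _) (suc k , →⊑ void⊑ p⊑)) }) ,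
  (λ { (k , p⊑) → codomain-prefix (proj₂ (e _) (suc k , →⊑ void⊑ p⊑)) })

domain-eq : ∀ {a b c d} → TreeEq (a ⇒ b) (c ⇒ d) → TreeEq a c
domain-eq e p =
  (λ { (k , p⊑) → domain-prefix (proj₁ (e _) (suc k , →⊑ p⊑ void⊑)) }) ,
  (λ { (k , p⊑) → domain-prefix (proj₂ (e _) (suc k , →⊑ p⊑ void⊑)) })

data Head : Set where
  sumH prodH funH : Head

headPrefix : Head → FT
headPrefix sumH  = fvoid +ᶠ fvoid
headPrefix prodH = fvoid ×ᶠ fvoid
headPrefix funH  = fvoid →ᶠ fvoid

HasHead : Ty → Head → Set
HasHead σ h = TypeTree σ (headPrefix h)

head-compatible : ∀ h h′ {t} → headPrefix h ⊑ t → headPrefix h′ ⊑ t → h ≡ h′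
head-compatible sumH  sumH  _        _  = refl
head-compatible prodH prodH _        _  = refl
head-compatible funH  funH  _        _  = refl
head-compatible sumH  prodH (+⊑ _ _) ()
head-compatible sumH  funH  (+⊑ _ _) ()
head-compatible prodH sumH  (×⊑ _ _) ()
head-compatible prodH funH  (×⊑ _ _) ()
head-compatible funH  sumH  (→⊑ _ _) ()
head-compatible funH  prodH (→⊑ _ _) ()

head-unique : ∀ {σ h h′} → HasHead σ h → HasHead σ h′ → h ≡ h′
head-unique {h = h} {h′} s t with tree-directed s t
... | _ , h⊑ , h′⊑ = head-compatible h h′ h⊑ h′⊑

sum-head : ∀ {τ ρ} → HasHead (τ ⊕ ρ) sumH
sum-head = 1 , +⊑ void⊑ void⊑

prod-head : ∀ {τ ρ} → HasHead (τ ⊗ ρ) prodH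
prod-head = 1 , ×⊑ void⊑ void⊑

arrows : ℕ → FT → FT
arrows zero    q = q
arrows (suc n) q = fvoid →ᶠ arrows n q

module _ {Γ : List Ty} where

  TypePrefix : Tm → FT → Set
  TypePrefix M p = ∀ {T} → Γ ⊢ M ∶ T → TypeTree T p

  app-inversion : ∀ {M N σ} → Γ ⊢ M · N ∶ σ →
    ∃₂ λ τ ρ → Γ ⊢ M ∶ (τ ⇒ ρ) × Γ ⊢ N ∶ τ × TreeEq ρ σ
  app-inversion (⊢app dM dN) = _ , _ , dM , dN , ≅-refl
  app-inversion (⊢conv d e) with app-inversion d
  ... | τ , ρ , dM , dN , e′ = τ , ρ , dM , dN , ≅-trans e′ e

  prefix-app : ∀ {M N p} → TypePrefix M (fvoid →ᶠ p) → TypePrefix (M · N) p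
  prefix-app M∶ d with app-inversion d
  ... | _ , _ , dM , _ , e = tree-transport (codomain-prefix (M∶ dM)) e

  prefix-fun : ∀ {M p T} → TypePrefix M (fvoid →ᶠ p) → Γ ⊢ M ∶ T → HasHead T funH
  prefix-fun M∶ d = tree-down (→⊑ void⊑ void⊑) (M∶ d)

  lam-prefix : ∀ {s M} → TypePrefix (lam s M) (arrows 1 fvoid)
  lam-prefix (⊢lam _)    = 1 , →⊑ void⊑ void⊑
  lam-prefix (⊢conv d e) = tree-transport (lam-prefix d) e

  c0-prefix : TypePrefix c0 (arrows 1 (headPrefix sumH))
  c0-prefix ⊢c0         = 2 , →⊑ void⊑ (+⊑ void⊑ void⊑)
  c0-prefix (⊢conv d e) = tree-transport (c0-prefix d) e

  c1-prefix : TypePrefix c1 (arrows 1 (headPrefix sumH))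
  c1-prefix ⊢c1         = 2 , →⊑ void⊑ (+⊑ void⊑ void⊑)
  c1-prefix (⊢conv d e) = tree-transport (c1-prefix d) e

  case-prefix : TypePrefix case (arrows 3 fvoid)
  case-prefix ⊢case       = 3 , →⊑ void⊑ (→⊑ void⊑ (→⊑ void⊑ void⊑))
  case-prefix (⊢conv d e) = tree-transport (case-prefix d) e

  pcase-prefix : TypePrefix pcase (arrows 3 fvoid)
  pcase-prefix ⊢pcase      = 3 , →⊑ void⊑ (→⊑ void⊑ (→⊑ void⊑ void⊑))
  pcase-prefix (⊢conv d e) = tree-transport (pcase-prefix d) e

  pair-prefix : TypePrefix pair (arrows 2 (headPrefix prodH))
  pair-prefix ⊢pair       = 3 , →⊑ void⊑ (→⊑ void⊑ (×⊑ void⊑ void⊑))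
  pair-prefix (⊢conv d e) = tree-transport (pair-prefix d) e

  fst-prefix : TypePrefix fst (arrows 1 fvoid)
  fst-prefix ⊢fst        = 1 , →⊑ void⊑ void⊑
  fst-prefix (⊢conv d e) = tree-transport (fst-prefix d) e

  snd-prefix : TypePrefix snd (arrows 1 fvoid)
  snd-prefix ⊢snd        = 1 , →⊑ void⊑ void⊑
  snd-prefix (⊢conv d e) = tree-transport (snd-prefix d) e

  pcase-inversion : ∀ {T} → Γ ⊢ pcase ∶ T →
    ∃₂ λ s t → ∃ λ r → TreeEq ((s ⊕ t) ⇒ r ⇒ r ⇒ r) T
  pcase-inversion ⊢pcase      = _ , _ , _ , ≅-refl
  pcase-inversion (⊢conv d e) with pcase-inversion d
  ... | s , t , r , e′ = s , t , r , ≅-trans e′ e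

  pcase₁-inversion : ∀ {x T} → Γ ⊢ pcase · x ∶ T → ∃ λ r → TreeEq (r ⇒ r ⇒ r) T
  pcase₁-inversion d with app-inversion d
  ... | _ , _ , d₀ , _ , e with pcase-inversion d₀
  ... | _ , _ , r , e₀ = r , ≅-trans (codomain-eq e₀) e

  pcase₂-inversion : ∀ {x y T} → Γ ⊢ pcase · x · y ∶ T →
    ∃ λ r → Γ ⊢ y ∶ r × TreeEq (r ⇒ r) T
  pcase₂-inversion d with app-inversion d
  ... | _ , _ , d₁ , y∶ , e with pcase₁-inversion d₁
  ... | r , e₁ = r , ⊢conv y∶ (≅-sym (domain-eq e₁)) , ≅-trans (codomain-eq e₁) e

  pcase-branch-type : ∀ {x y z T} → Γ ⊢ pcase · x · y · z ∶ T → Γ ⊢ y ∶ T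
  pcase-branch-type d with app-inversion d
  ... | _ , _ , d₂ , _ , e with pcase₂-inversion d₂
  ... | _ , y∶ , e₂ = ⊢conv y∶ (≅-trans (codomain-eq e₂) e)

data Form : Set where
  left right prod func : Form

form : Prime → Form
form tag0       = left
form (in0 _)    = left
form tag1       = right
form (in1 _)    = right
form (pr0 _)    = prod
form (pr1 _)    = prod
form (step _ _) = func

form-mono : ∀ {p q} → p ≤ᵖ q → form p ≡ form q
form-mono t0≤      = refl
form-mono t1≤      = refl
form-mono t0≤i0    = refl
form-mono t1≤i1    = refl
form-mono (i0≤ _)  = refl
form-mono (i1≤ _)  = refl
form-mono (p0≤ _)  = refl
form-mono (p1≤ _)  = refl
form-mono (st≤ _ _) = refl

formHead : Form → Head
formHead left  = sumH
formHead right = sumH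
formHead prod  = prodH
formHead func  = funH

fun-form : ∀ {F} p → fun F p → form p ≡ func
fun-form (step _ _) _ = refl
fun-form tag0    ()
fun-form tag1    ()
fun-form (in0 _) ()
fun-form (in1 _) ()
fun-form (pr0 _) ()
fun-form (pr1 _) ()

inj0-form : ∀ {d} p → inj0 d p → form p ≡ left
inj0-form tag0       _ = refl
inj0-form (in0 _)    _ = refl
inj0-form tag1       ()
inj0-form (in1 _)    ()
inj0-form (pr0 _)    ()
inj0-form (pr1 _)    ()
inj0-form (step _ _) ()

inj1-form : ∀ {d} p → inj1 d p → form p ≡ right
inj1-form tag1       _ = refl
inj1-form (in1 _)    _ = refl
inj1-form tag0       ()
inj1-form (in0 _)    ()
inj1-form (pr0 _)    ()
inj1-form (pr1 _)    ()
inj1-form (step _ _) ()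

pairS-form : ∀ {d e} p → pairS d e p → form p ≡ prod
pairS-form (pr0 _)    _ = refl
pairS-form (pr1 _)    _ = refl
pairS-form tag0       ()
pairS-form tag1       ()
pairS-form (in0 _)    ()
pairS-form (in1 _)    ()
pairS-form (step _ _) ()

mutual
  -- Canonical A f: A is a normal form whose shape is the one forced by a
  -- prime of form f.  The function forms are the abstractions, the
  -- unsaturated constants and pcase x y z with y of function form; for the
  -- partial applications of case and pcase we also record that the
  -- already supplied arguments are canonical for all their primes, which is
  -- what rules out redexes once the last argument arrives.
  data Canonical : Tm → Form → Set where
    sum-inl    : ∀ {x} → Canonical (c0 · x) left
    sum-inr    : ∀ {x} → Canonical (c1 · x) right
    prod-pair  : ∀ {x y} → Canonical (pair · x · y) prod
    fun-lam    : ∀ {s M} → Canonical (lam s M) func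
    fun-c0     : Canonical c0 func
    fun-c1     : Canonical c1 func
    fun-case   : Canonical case func
    fun-case₁  : ∀ {x} → CanonicalPrimes x → Canonical (case · x) func
    fun-case₂  : ∀ {x y} → CanonicalPrimes x → Canonical (case · x · y) func
    fun-pcase  : Canonical pcase func
    fun-pcase₁ : ∀ {x} → CanonicalPrimes x → Canonical (pcase · x) func
    fun-pcase₂ : ∀ {x y} → CanonicalPrimes x → CanonicalPrimes y →
                 Canonical (pcase · x · y) func
    fun-pcase₃ : ∀ {x y z} → Canonical y func → Canonical (pcase · x · y · z) func
    fun-pair   : Canonical pair func
    fun-pair₁  : ∀ {x} → Canonical (pair · x) func
    fun-fst    : Canonical fst func
    fun-snd    : Canonical snd func

  CanonicalPrimes : Tm → Set
  CanonicalPrimes x = ∀ r → ⟦ x ⟧ ⊥ₑ r → Canonical x (form r)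

reform : ∀ {A p f} → form p ≡ f → Canonical A f → Canonical A (form p)
reform refl c = c

canonical-below : ∀ {x a p} → CanonicalPrimes x → All (⟦ x ⟧ ⊥ₑ) a → ↓ a p →
  Canonical x (form p)
canonical-below cx xs p≤ with lookupAny xs p≤
... | w∈x , p≤w = reform (form-mono p≤w) (cx _ w∈x)

case-stuck : ∀ {x y z a b c p} → Normal (case · x · y · z) → CanonicalPrimes x →
  All (⟦ x ⟧ ⊥ₑ) c → ¬ caseS (↓ c) (↓ b) (↓ a) p
case-stuck nf cx xs (inj₁ (tag0∈ , _)) with canonical-below cx xs tag0∈
... | sum-inl = nf _ case0
case-stuck nf cx xs (inj₂ (tag1∈ , _)) with canonical-below cx xs tag1∈
... | sum-inr = nf _ case1

pcase-branches : ∀ {x y z f} → Normal (pcase · x · y · z) →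
  Canonical y f → Canonical z f → Canonical (pcase · x · y · z) f
pcase-branches {f = left}  nf sum-inl   sum-inl   = ⊥-elim (nf _ pcase00)
pcase-branches {f = right} nf sum-inr   sum-inr   = ⊥-elim (nf _ pcase11)
pcase-branches {f = prod}  nf prod-pair prod-pair = ⊥-elim (nf _ pcasePr)
pcase-branches {f = func}  _  cy        _         = fun-pcase₃ cy

pcase-canonical : ∀ {x y z a b c p} → Normal (pcase · x · y · z) →
  CanonicalPrimes x → CanonicalPrimes y → CanonicalPrimes z →
  All (⟦ x ⟧ ⊥ₑ) c → All (⟦ y ⟧ ⊥ₑ) b → All (⟦ z ⟧ ⊥ₑ) a →
  pcaseS (↓ c) (↓ b) (↓ a) p → Canonical (pcase · x · y · z) (form p)
pcase-canonical nf cx _ _ xs _ _ (inj₁ (tag0∈ , _)) with canonical-below cx xs tag0∈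
... | sum-inl = ⊥-elim (nf _ pcase0)
pcase-canonical nf cx _ _ xs _ _ (inj₂ (inj₁ (tag1∈ , _))) with canonical-below cx xs tag1∈
... | sum-inr = ⊥-elim (nf _ pcase1)
pcase-canonical nf _ cy cz _ ys zs (inj₂ (inj₂ (p∈y , p∈z))) =
  pcase-branches nf (canonical-below cy ys p∈y) (canonical-below cz zs p∈z)

canonical-app : ∀ {M N a p} → Canonical M func → Normal (M · N) →
  ⟦ M ⟧ ⊥ₑ (step a p) → All (⟦ N ⟧ ⊥ₑ) a → CanonicalPrimes N →
  Canonical (M · N) (form p)
canonical-app fun-lam nf _ _ _ = ⊥-elim (nf _ β)
canonical-app {p = p} fun-c0 _ (_ , h) _ _ = reform (inj0-form p h) sum-inl
canonical-app {p = p} fun-c1 _ (_ , h) _ _ = reform (inj1-form p h) sum-inr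
canonical-app {p = p} fun-case _ (_ , h) _ cN = reform (fun-form p h) (fun-case₁ cN)
canonical-app {p = p} (fun-case₁ cx) _ (_ , (_ , _ , h) , _) _ _ =
  reform (fun-form p h) (fun-case₂ cx)
canonical-app (fun-case₂ cx) nf (_ , (_ , (_ , _ , _ , h) , xs) , _) _ _ =
  ⊥-elim (case-stuck nf cx xs h)
canonical-app {p = p} fun-pcase _ (_ , h) _ cN = reform (fun-form p h) (fun-pcase₁ cN)
canonical-app {p = p} (fun-pcase₁ cx) _ (_ , (_ , _ , h) , _) _ cN =
  reform (fun-form p h) (fun-pcase₂ cx cN)
canonical-app (fun-pcase₂ cx cy) nf (_ , (_ , (_ , _ , _ , h) , xs) , ys) zs cz =
  pcase-canonical nf cx cy cz xs ys zs h
canonical-app (fun-pcase₃ _) nf _ _ _ = ⊥-elim (nf _ pcaseAp)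
canonical-app {p = p} fun-pair _ (_ , h) _ _ = reform (fun-form p h) fun-pair₁
canonical-app {p = p} fun-pair₁ _ (_ , (_ , _ , h) , _) _ _ =
  reform (pairS-form p h) prod-pair
canonical-app fun-fst nf (_ , pr0p∈) ns cN with canonical-below cN ns pr0p∈
... | prod-pair = ⊥-elim (nf _ fstβ)
canonical-app fun-snd nf (_ , pr1p∈) ns cN with canonical-below cN ns pr1p∈
... | prod-pair = ⊥-elim (nf _ sndβ)

normal-fun : ∀ {M N} → Normal (M · N) → Normal M
normal-fun nf _ M⟶ = nf _ (ξ₁ M⟶)

normal-arg : ∀ {M N} → Normal (M · N) → Normal N
normal-arg nf _ N⟶ = nf _ (ξ₂ N⟶)

canonical : ∀ A p → Normal A → ⟦ A ⟧ ⊥ₑ p → Canonical A (form p)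
canonical (var _)   _ _ ()
canonical Ω         _ _ ()
canonical (lam _ _) p _ h = reform (fun-form p h) fun-lam
canonical c0        p _ h = reform (fun-form p h) fun-c0
canonical c1        p _ h = reform (fun-form p h) fun-c1
canonical case      p _ h = reform (fun-form p h) fun-case
canonical pcase     p _ h = reform (fun-form p h) fun-pcase
canonical pair      p _ h = reform (fun-form p h) fun-pair
canonical fst       p _ h = reform (fun-form p h) fun-fst
canonical snd       p _ h = reform (fun-form p h) fun-snd
canonical (M · N)   p nf (a , hM , hN) =
  canonical-app (canonical M (step a p) (normal-fun nf) hM) nf hM hN
    (λ r → canonical N r (normal-arg nf))

canonical-head : ∀ {Γ A σ f} → Γ ⊢ A ∶ σ → Canonical A f → HasHead σ (formHead f)
canonical-head d sum-inl          = prefix-app c0-prefix d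
canonical-head d sum-inr          = prefix-app c1-prefix d
canonical-head d prod-pair        = prefix-app (prefix-app pair-prefix) d
canonical-head d fun-lam          = prefix-fun lam-prefix d
canonical-head d fun-c0           = prefix-fun c0-prefix d
canonical-head d fun-c1           = prefix-fun c1-prefix d
canonical-head d fun-case         = prefix-fun case-prefix d
canonical-head d (fun-case₁ _)    = prefix-fun (prefix-app case-prefix) d
canonical-head d (fun-case₂ _)    = prefix-fun (prefix-app (prefix-app case-prefix)) d
canonical-head d fun-pcase        = prefix-fun pcase-prefix d
canonical-head d (fun-pcase₁ _)   = prefix-fun (prefix-app pcase-prefix) d
canonical-head d (fun-pcase₂ _ _) = prefix-fun (prefix-app (prefix-app pcase-prefix)) d
canonical-head d (fun-pcase₃ cy)  = canonical-head (pcase-branch-type d) cy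
canonical-head d fun-pair         = prefix-fun pair-prefix d
canonical-head d fun-pair₁        = prefix-fun (prefix-app pair-prefix) d
canonical-head d fun-fst          = prefix-fun fst-prefix d
canonical-head d fun-snd          = prefix-fun snd-prefix d

canonical-property : ∀ {Γ A σ h} {S : Set} → Γ ⊢ A ∶ σ → Normal A →
  ¬ (∀ p → ¬ ⟦ A ⟧ ⊥ₑ p) → HasHead σ h → Dec S →
  (∀ f → Canonical A f → formHead f ≡ h → S) → S
canonical-property {A = A} A∶σ nf nonempty σh S? extract =
  decidable-stable S? λ ¬S → nonempty λ p p∈A →
    let cA = canonical A p nf p∈A
    in ¬S (extract (form p) cA (head-unique (canonical-head A∶σ cA) σh))

SumShape : Tm → Set
SumShape A = ∃ λ A′ → (A ≡ c0 · A′) ⊎ (A ≡ c1 · A′)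

PairShape : Tm → Set
PairShape A = ∃₂ λ A′ A″ → A ≡ pair · A′ · A″

sum-shape? : ∀ A → Dec (SumShape A)
sum-shape? (c0 · x)      = yes (x , inj₁ refl)
sum-shape? (c1 · x)      = yes (x , inj₂ refl)
sum-shape? (var _ · _)   = no λ { (_ , inj₁ ()) ; (_ , inj₂ ()) }
sum-shape? (lam _ _ · _) = no λ { (_ , inj₁ ()) ; (_ , inj₂ ()) }
sum-shape? (_ · _ · _)   = no λ { (_ , inj₁ ()) ; (_ , inj₂ ()) }
sum-shape? (case · _)    = no λ { (_ , inj₁ ()) ; (_ , inj₂ ()) }
sum-shape? (pcase · _)   = no λ { (_ , inj₁ ()) ; (_ , inj₂ ()) }
sum-shape? (pair · _)    = no λ { (_ , inj₁ ()) ; (_ , inj₂ ()) }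
sum-shape? (fst · _)     = no λ { (_ , inj₁ ()) ; (_ , inj₂ ()) }
sum-shape? (snd · _)     = no λ { (_ , inj₁ ()) ; (_ , inj₂ ()) }
sum-shape? (Ω · _)       = no λ { (_ , inj₁ ()) ; (_ , inj₂ ()) }
sum-shape? (var _)       = no λ { (_ , inj₁ ()) ; (_ , inj₂ ()) }
sum-shape? (lam _ _)     = no λ { (_ , inj₁ ()) ; (_ , inj₂ ()) }
sum-shape? c0            = no λ { (_ , inj₁ ()) ; (_ , inj₂ ()) }
sum-shape? c1            = no λ { (_ , inj₁ ()) ; (_ , inj₂ ()) }
sum-shape? case          = no λ { (_ , inj₁ ()) ; (_ , inj₂ ()) }
sum-shape? pcase         = no λ { (_ , inj₁ ()) ; (_ , inj₂ ()) }
sum-shape? pair          = no λ { (_ , inj₁ ()) ; (_ , inj₂ ()) }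
sum-shape? fst           = no λ { (_ , inj₁ ()) ; (_ , inj₂ ()) }
sum-shape? snd           = no λ { (_ , inj₁ ()) ; (_ , inj₂ ()) }
sum-shape? Ω             = no λ { (_ , inj₁ ()) ; (_ , inj₂ ()) }

pair-shape? : ∀ A → Dec (PairShape A)
pair-shape? (pair · x · y)      = yes (x , y , refl)
pair-shape? (var _ · _ · _)     = no λ { (_ , _ , ()) }
pair-shape? (lam _ _ · _ · _)   = no λ { (_ , _ , ()) }
pair-shape? (_ · _ · _ · _)     = no λ { (_ , _ , ()) }
pair-shape? (c0 · _ · _)        = no λ { (_ , _ , ()) }
pair-shape? (c1 · _ · _)        = no λ { (_ , _ , ()) }
pair-shape? (case · _ · _)      = no λ { (_ , _ , ()) }
pair-shape? (pcase · _ · _)     = no λ { (_ , _ , ()) }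
pair-shape? (fst · _ · _)       = no λ { (_ , _ , ()) }
pair-shape? (snd · _ · _)       = no λ { (_ , _ , ()) }
pair-shape? (Ω · _ · _)         = no λ { (_ , _ , ()) }
pair-shape? (var _ · _)         = no λ { (_ , _ , ()) }
pair-shape? (lam _ _ · _)       = no λ { (_ , _ , ()) }
pair-shape? (c0 · _)            = no λ { (_ , _ , ()) }
pair-shape? (c1 · _)            = no λ { (_ , _ , ()) }
pair-shape? (case · _)          = no λ { (_ , _ , ()) }
pair-shape? (pcase · _)         = no λ { (_ , _ , ()) }
pair-shape? (pair · _)          = no λ { (_ , _ , ()) }
pair-shape? (fst · _)           = no λ { (_ , _ , ()) }
pair-shape? (snd · _)           = no λ { (_ , _ , ()) }
pair-shape? (Ω · _)             = no λ { (_ , _ , ()) }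
pair-shape? (var _)             = no λ { (_ , _ , ()) }
pair-shape? (lam _ _)           = no λ { (_ , _ , ()) }
pair-shape? c0                  = no λ { (_ , _ , ()) }
pair-shape? c1                  = no λ { (_ , _ , ()) }
pair-shape? case                = no λ { (_ , _ , ()) }
pair-shape? pcase               = no λ { (_ , _ , ()) }
pair-shape? pair                = no λ { (_ , _ , ()) }
pair-shape? fst                 = no λ { (_ , _ , ()) }
pair-shape? snd                 = no λ { (_ , _ , ()) }
pair-shape? Ω                   = no λ { (_ , _ , ()) }

sum-form-shape : ∀ {A} f → Canonical A f → formHead f ≡ sumH → SumShape A
sum-form-shape left  sum-inl _ = _ , inj₁ refl
sum-form-shape right sum-inr _ = _ , inj₂ refl
sum-form-shape prod  _       ()
sum-form-shape func  _       ()

prod-form-shape : ∀ {A} f → Canonical A f → formHead f ≡ prodH → PairShape A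
prod-form-shape prod  prod-pair _ = _ , _ , refl
prod-form-shape left  _         ()
prod-form-shape right _         ()
prod-form-shape func  _         ()

mainTheorem15 : (Γ : List Ty) (σ : Ty) (A : Tm) →
    Γ ⊢ A ∶ σ → Normal A → ¬ (∀ p → ¬ ⟦ A ⟧ ⊥ₑ p) →
    ((τ ρ : Ty) → TreeEq σ (τ ⊕ ρ) → ∃ λ A′ → (A ≡ c0 · A′) ⊎ (A ≡ c1 · A′))
    × ((τ ρ : Ty) → TreeEq σ (τ ⊗ ρ) → ∃₂ λ A′ A″ → A ≡ pair · A′ · A″)
mainTheorem15 Γ σ A A∶σ nf nonempty = sum-case , product-case
  where
  sum-case : (τ ρ : Ty) → TreeEq σ (τ ⊕ ρ) → SumShape A
  sum-case τ ρ σ≅ =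
    canonical-property A∶σ nf nonempty (tree-transport sum-head (≅-sym σ≅))
      (sum-shape? A) sum-form-shape

  product-case : (τ ρ : Ty) → TreeEq σ (τ ⊗ ρ) → PairShape A
  product-case τ ρ σ≅ =
    canonical-property A∶σ nf nonempty (tree-transport prod-head (≅-sym σ≅))
      (pair-shape? A) prod-form-shape
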